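{- Let $t(n)$ be a sequence of natural numbers, let $\mathrm{GF}_t(z)=\sum_{i=0}^\infty t(i)z^i$ be its generating function and let $R$ be the radius of convergence of $\mathrm{GF}_t(z)$ at zero. Let $b$, $m$, $n$ be integers such that $b\ge 2$, $n\ge m\ge 2$, $b^{ -m}<R$, and $t(r)<b^{r-2}$ for every integer $r\ge m$. Then $$t(n)=\left\lfloor b^{n^2}\,\mathrm{GF}_t(b^{ -n})\right\rfloor \bmod b^n .$$
   Context: Natural numbers are the non-negative integers. $\mathrm{GF}_t(b^{ -n})$ denotes the (real) sum of the power series $\sum_{i\ge 0} t(i) b^{ -ni}$. For an integer $y\ge 1$, $x \bmod y$ denotes the least non-negative residue of $x$ modulo $y$. -}

module Defs where

open import Data.Nat as ℕ using (ℕ; zero; suc)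
open import Data.Nat.DivMod using (_%_)
open import Data.Integer using (+_)
open import Data.Rational using (ℚ; 0ℚ; 1ℚ; _/_; _+_; _*_; _<_; _≤_)
open import Data.Product using (Σ; _×_)

ℕ→ℚ : ℕ → ℚ
ℕ→ℚ k = (+ k) / 1

-- 1/d as a rational (junk value 0 for d = 0; only used with d ≥ 1)
recipℕ : ℕ → ℚ
recipℕ zero = 0ℚ
recipℕ (suc d) = (+ 1) / suc d

-- x mod y, least non-negative residue (junk: x mod 0 = x; only used with y ≥ 1)
modℕ : ℕ → ℕ → ℕ
modℕ x zero = x
modℕ x (suc d) = x % suc d

powℚ : ℚ → ℕ → ℚ
powℚ z zero = 1ℚ
powℚ z (suc k) = z * powℚ z k

partialGF : (ℕ → ℕ) → ℚ → ℕ → ℚ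
partialGF t z zero = 0ℚ
partialGF t z (suc N) = partialGF t z N + ℕ→ℚ (t N) * powℚ z N

-- "the radius of convergence R of GF_t at zero satisfies x < R", with
-- R = sup { r ≥ 0 : the sequence t(i) r^i is bounded }.  Since this set is
-- downward closed, x < R iff some rational r > x lies in it.
RadiusGreaterThan : (ℕ → ℕ) → ℚ → Set
RadiusGreaterThan t x =
  Σ ℚ λ r → x < r × Σ ℚ λ M → ∀ i → ℕ→ℚ (t i) * powℚ r i ≤ M

-- "k = ⌊ lim_N s N ⌋" for a sequence s of partial sums of a series with
-- non-negative terms (so s is non-decreasing and the limit is its supremum):
-- k ≤ sup s  (every rational below k is exceeded by some s N)  and
-- sup s < k + 1 (some rational below k+1 bounds all s N).
IsFloorOfLimit : ℕ → (ℕ → ℚ) → Set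
IsFloorOfLimit k s =
  (∀ q → q < ℕ→ℚ k → Σ ℕ λ N → q < s N)
  × Σ ℚ λ q → q < ℕ→ℚ (suc k) × (∀ N → s N ≤ q)

module Submission where

open import Defs
open import Data.Nat using (ℕ; _≤_; _<_; _^_; _*_; _∸_)
open import Data.Product using (Σ; _×_)
open import Data.Rational using () renaming (_*_ to _*ℚ_)
open import Relation.Binary.PropositionalEquality using (_≡_)

open import Data.Nat using (zero; suc; pred; _+_; z≤n; s≤s; NonZero; >-nonZero; >-nonZero⁻¹)
open import Data.Nat.Properties
open import Data.Nat.DivMod using (_%_; %-remove-+ˡ; m<n⇒m%n≡m)
open import Data.Nat.Divisibility using (m∣m*n)
open import Data.Nat.Coprimality using (1-coprimeTo) renaming (sym to coprime-sym)
open import Data.Nat.Tactic.RingSolver using (solve-∀)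
open import Data.Integer as ℤ using (+≤+; +<+)
import Data.Integer.Properties as ℤP
open import Data.Rational as ℚ using (ℚ; mkℚ; 0ℚ; 1ℚ; *≤*; *<*; positive)
  renaming (_+_ to _+ℚ_; _≤_ to _≤ℚ_; _<_ to _<ℚ_)
import Data.Rational.Properties as ℚP
open import Algebra.Bundles using (CommutativeRing)
open import Algebra.Properties.CommutativeSemigroup
  (CommutativeRing.*-commutativeSemigroup ℚP.+-*-commutativeRing) using (interchange; x∙yz≈y∙xz)
open import Data.Product using (_,_)
open import Relation.Binary.PropositionalEquality
  using (refl; sym; trans; cong; cong₂; subst; subst₂; module ≡-Reasoning)

-- Put D = b^n.  Then b^(n²) Σ_{i<N} t(i) D^(-i) = D^n Σ_{i<N} t(i) D^(-i) is the base-D numeral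
-- with digits t(0), …, t(N-1) whose units digit is t(n).  At N = n + 1 it is the integer
-- k = Σ_{i≤n} t(i) D^(n-i), and k mod D = t(n) because t(n) < D.  The digits after t(n)
-- satisfy t(n+1+j) < b^(n-1+j), so they are dominated by a geometric series and add at most
-- 1 - 1/D; so every partial sum is at most k + 1 - 1/D, while the (n+1)-st equals k: ⌊limit⌋ = k.

horner : ℕ → (ℕ → ℕ) → ℕ → ℕ
horner D u zero    = 0
horner D u (suc E) = D * horner D u E + u E

horner-+ : ∀ D u m E →
  horner D u (m + E) ≡ D ^ E * horner D u m + horner D (λ j → u (m + j)) E
horner-+ D u m zero = begin
  horner D u (m + 0)   ≡⟨ cong (horner D u) (+-identityʳ m) ⟩
  horner D u m         ≡⟨ sym (trans (+-identityʳ _) (*-identityˡ _)) ⟩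
  1 * horner D u m + 0 ∎
  where open ≡-Reasoning
horner-+ D u m (suc E) = begin
  horner D u (m + suc E)                           ≡⟨ cong (horner D u) (+-suc m E) ⟩
  D * horner D u (m + E) + u (m + E)               ≡⟨ cong (λ h → D * h + u (m + E)) (horner-+ D u m E) ⟩
  D * (D ^ E * horner D u m + T) + u (m + E)       ≡⟨ distrib D (D ^ E) (horner D u m) T (u (m + E)) ⟩
  D * D ^ E * horner D u m + (D * T + u (m + E))   ∎
  where
  open ≡-Reasoning
  T : ℕ
  T = horner D (λ j → u (m + j)) E
  distrib : ∀ a b c d e → a * (b * c + d) + e ≡ a * b * c + (a * d + e)
  distrib = solve-∀

m+m≤n*m : ∀ {n} m → 2 ≤ n → m + m ≤ n * m
m+m≤n*m {n} m 2≤n = begin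
  m + m     ≡⟨ cong (m +_) (sym (+-identityʳ m)) ⟩
  2 * m     ≤⟨ *-monoˡ-≤ m 2≤n ⟩
  n * m     ∎
  where open ≤-Reasoning

module _ {b e : ℕ} (2≤b : 2 ≤ b) (1≤e : 1 ≤ e) (u : ℕ → ℕ) (u<b^[e+j] : ∀ j → u j < b ^ (e + j)) where

  private
    D : ℕ
    D = b ^ suc e

    instance
      b≢0 : NonZero b
      b≢0 = >-nonZero (≤-trans (s≤s z≤n) 2≤b)

    1+u+b^≤b*b^ : ∀ j → suc (u j) + b ^ (e + j) ≤ b * b ^ (e + j)
    1+u+b^≤b*b^ j = ≤-trans (+-monoˡ-≤ (b ^ (e + j)) (u<b^[e+j] j)) (m+m≤n*m (b ^ (e + j)) 2≤b)

    b^[1+e+j]≤D*b^[e+j] : ∀ j → b * b ^ (e + suc j) ≤ D * b ^ (e + j)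
    b^[1+e+j]≤D*b^[e+j] j = begin
      b ^ suc (e + suc j)    ≤⟨ ^-monoʳ-≤ b (s≤s (+-monoʳ-≤ e (+-monoˡ-≤ j 1≤e))) ⟩
      b ^ (suc e + (e + j))  ≡⟨ ^-distribˡ-+-* b (suc e) (e + j) ⟩
      D * b ^ (e + j)        ∎
      where open ≤-Reasoning

  -- The term b^(e+E) pays for the next digit: u (E+1) + b^(e+E+1) ≤ b^(e+E+2) ≤ D · b^(e+E).
  horner-tail-invariant : ∀ E → horner D u (suc E) + D ^ E + b ^ (e + E) ≤ D ^ suc E
  horner-tail-invariant zero = begin
    D * 0 + u 0 + 1 + b ^ (e + 0)  ≡⟨ cong (λ k → k + u 0 + 1 + b ^ (e + 0)) (*-zeroʳ D) ⟩
    u 0 + 1 + b ^ (e + 0)          ≡⟨ cong (_+ b ^ (e + 0)) (+-comm (u 0) 1) ⟩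
    suc (u 0) + b ^ (e + 0)        ≤⟨ 1+u+b^≤b*b^ 0 ⟩
    b ^ suc (e + 0)                ≡⟨ cong (λ k → b ^ suc k) (+-identityʳ e) ⟩
    D                              ≡⟨ sym (*-identityʳ D) ⟩
    D * 1                          ∎
    where open ≤-Reasoning
  horner-tail-invariant (suc E) = begin
    D * h + u (suc E) + D * D ^ E + b ^ (e + suc E)
      ≡⟨ regroup D h (u (suc E)) (D ^ E) (b ^ (e + suc E)) ⟩
    H + (u (suc E) + b ^ (e + suc E))
      ≤⟨ +-monoʳ-≤ H (+-monoˡ-≤ (b ^ (e + suc E)) (n≤1+n (u (suc E)))) ⟩
    H + (suc (u (suc E)) + b ^ (e + suc E))
      ≤⟨ +-monoʳ-≤ H (1+u+b^≤b*b^ (suc E)) ⟩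
    H + b * b ^ (e + suc E)
      ≤⟨ +-monoʳ-≤ H (b^[1+e+j]≤D*b^[e+j] E) ⟩
    H + D * b ^ (e + E)
      ≡⟨ sym (*-distribˡ-+ D (h + D ^ E) (b ^ (e + E))) ⟩
    D * (h + D ^ E + b ^ (e + E))
      ≤⟨ *-monoʳ-≤ D (horner-tail-invariant E) ⟩
    D * D ^ suc E
      ∎
    where
    open ≤-Reasoning
    h H : ℕ
    h = horner D u (suc E)
    H = D * (h + D ^ E)
    regroup : ∀ d h v p w → d * h + v + d * p + w ≡ d * (h + p) + (v + w)
    regroup = solve-∀

  horner-tail-bound : ∀ E → D * horner D u E + D ^ E ≤ D ^ suc E
  horner-tail-bound zero = begin
    D * 0 + 1  ≡⟨ cong (_+ 1) (*-zeroʳ D) ⟩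
    1          ≤⟨ m^n>0 b (suc e) ⟩
    D          ≡⟨ sym (*-identityʳ D) ⟩
    D * 1      ∎
    where open ≤-Reasoning
  horner-tail-bound (suc E) = begin
    D * horner D u (suc E) + D * D ^ E  ≡⟨ sym (*-distribˡ-+ D _ (D ^ E)) ⟩
    D * (horner D u (suc E) + D ^ E)    ≤⟨ *-monoʳ-≤ D (m+n≤o⇒m≤o _ (horner-tail-invariant E)) ⟩
    D * D ^ suc E                       ∎
    where open ≤-Reasoning

horner-suc-mod : ∀ D u n → u n < D → modℕ (horner D u (suc n)) D ≡ u n
horner-suc-mod zero    u n ()
horner-suc-mod (suc d) u n u<D = begin
  (suc d * horner (suc d) u n + u n) % suc d  ≡⟨ %-remove-+ˡ (u n) (m∣m*n (horner (suc d) u n)) ⟩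
  u n % suc d                                 ≡⟨ m<n⇒m%n≡m u<D ⟩
  u n                                         ∎
  where open ≡-Reasoning

ℕ→ℚ≡mkℚ : ∀ k → ℕ→ℚ k ≡ mkℚ (ℤ.+ k) 0 (coprime-sym (1-coprimeTo k))
ℕ→ℚ≡mkℚ k = ℚP.normalize-coprime (coprime-sym (1-coprimeTo k))

ℕ→ℚ-+ : ∀ a b → ℕ→ℚ (a + b) ≡ ℕ→ℚ a +ℚ ℕ→ℚ b
ℕ→ℚ-+ a b rewrite ℕ→ℚ≡mkℚ a | ℕ→ℚ≡mkℚ b = cong (ℚ._/ 1) numerator
  where
  numerator : ℤ.+ (a + b) ≡ ℤ.+ a ℤ.* ℤ.+ 1 ℤ.+ ℤ.+ b ℤ.* ℤ.+ 1
  numerator = trans (ℤP.pos-+ a b)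
    (sym (cong₂ ℤ._+_ (ℤP.*-identityʳ (ℤ.+ a)) (ℤP.*-identityʳ (ℤ.+ b))))

ℕ→ℚ-* : ∀ a b → ℕ→ℚ (a * b) ≡ ℕ→ℚ a *ℚ ℕ→ℚ b
ℕ→ℚ-* a b rewrite ℕ→ℚ≡mkℚ a | ℕ→ℚ≡mkℚ b = cong (ℚ._/ 1) (ℤP.pos-* a b)

ℕ→ℚ-mono-≤ : ∀ {a b} → a ≤ b → ℕ→ℚ a ≤ℚ ℕ→ℚ b
ℕ→ℚ-mono-≤ {a} {b} a≤b rewrite ℕ→ℚ≡mkℚ a | ℕ→ℚ≡mkℚ b =
  *≤* (ℤP.*-monoʳ-≤-nonNeg (ℤ.+ 1) (+≤+ a≤b))

ℕ→ℚ-mono-< : ∀ {a b} → a < b → ℕ→ℚ a <ℚ ℕ→ℚ b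
ℕ→ℚ-mono-< {a} {b} a<b rewrite ℕ→ℚ≡mkℚ a | ℕ→ℚ≡mkℚ b =
  *<* (ℤP.*-monoʳ-<-pos (ℤ.+ 1) (+<+ a<b))

ℕ→ℚ-nonNeg : ∀ k → 0ℚ ≤ℚ ℕ→ℚ k
ℕ→ℚ-nonNeg k = ℕ→ℚ-mono-≤ {0} {k} z≤n

*-nonNeg : ∀ {p q} → 0ℚ ≤ℚ p → 0ℚ ≤ℚ q → 0ℚ ≤ℚ p *ℚ q
*-nonNeg {p} {q} 0≤p 0≤q =
  ℚP.nonNegative⁻¹ _ {{ℚP.nonNeg*nonNeg⇒nonNeg p {{ℚ.nonNegative 0≤p}} q {{ℚ.nonNegative 0≤q}}}}

ℕ→ℚ-*-assoc : ∀ a b {r c} → ℕ→ℚ b *ℚ r ≡ ℕ→ℚ c → ℕ→ℚ (a * b) *ℚ r ≡ ℕ→ℚ (a * c)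
ℕ→ℚ-*-assoc a b {r} {c} br≡c = begin
  ℕ→ℚ (a * b) *ℚ r          ≡⟨ cong (_*ℚ r) (ℕ→ℚ-* a b) ⟩
  ℕ→ℚ a *ℚ ℕ→ℚ b *ℚ r       ≡⟨ ℚP.*-assoc (ℕ→ℚ a) (ℕ→ℚ b) r ⟩
  ℕ→ℚ a *ℚ (ℕ→ℚ b *ℚ r)     ≡⟨ cong (ℕ→ℚ a *ℚ_) br≡c ⟩
  ℕ→ℚ a *ℚ ℕ→ℚ c            ≡⟨ sym (ℕ→ℚ-* a c) ⟩
  ℕ→ℚ (a * c)               ∎
  where open ≡-Reasoning

module _ (M : ℕ) .{{_ : NonZero M}} {r s : ℚ} {a c : ℕ}
         (Mr≡a : ℕ→ℚ M *ℚ r ≡ ℕ→ℚ a) (Ms≡c : ℕ→ℚ M *ℚ s ≡ ℕ→ℚ c) where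

  private
    instance
      M>0 : ℚ.Positive (ℕ→ℚ M)
      M>0 = positive (ℕ→ℚ-mono-< (>-nonZero⁻¹ M))

  ℕ-scaled-≤ : a ≤ c → r ≤ℚ s
  ℕ-scaled-≤ a≤c =
    ℚP.*-cancelˡ-≤-pos (ℕ→ℚ M) (subst₂ _≤ℚ_ (sym Mr≡a) (sym Ms≡c) (ℕ→ℚ-mono-≤ a≤c))

  ℕ-scaled-< : a < c → r <ℚ s
  ℕ-scaled-< a<c = ℚP.*-cancelˡ-<-nonNeg (ℕ→ℚ M) {{ℚP.pos⇒nonNeg (ℕ→ℚ M)}}
    (subst₂ _<ℚ_ (sym Mr≡a) (sym Ms≡c) (ℕ→ℚ-mono-< a<c))

ℕ→ℚ-*-recipℕ : ∀ D .{{_ : NonZero D}} → ℕ→ℚ D *ℚ recipℕ D ≡ 1ℚ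
ℕ→ℚ-*-recipℕ (suc d)
  rewrite ℕ→ℚ≡mkℚ (suc d) | ℚP.normalize-coprime {1} {d} (1-coprimeTo (suc d)) =
  ℚP.*-inverseʳ (mkℚ (ℤ.+ suc d) 0 (coprime-sym (1-coprimeTo (suc d))))

recipℕ-nonNeg : ∀ D → 0ℚ ≤ℚ recipℕ D
recipℕ-nonNeg zero    = ℚP.≤-refl
recipℕ-nonNeg (suc d) = ℚP.nonNegative⁻¹ _ {{ℚP.normalize-nonNeg 1 (suc d)}}

ℕ→ℚ-^-*-powℚ-recipℕ : ∀ D .{{_ : NonZero D}} N → ℕ→ℚ (D ^ N) *ℚ powℚ (recipℕ D) N ≡ 1ℚ
ℕ→ℚ-^-*-powℚ-recipℕ D zero    = refl
ℕ→ℚ-^-*-powℚ-recipℕ D (suc N) = begin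
  ℕ→ℚ (D * D ^ N) *ℚ (x *ℚ powℚ x N)
    ≡⟨ cong (_*ℚ (x *ℚ powℚ x N)) (ℕ→ℚ-* D (D ^ N)) ⟩
  ℕ→ℚ D *ℚ ℕ→ℚ (D ^ N) *ℚ (x *ℚ powℚ x N)
    ≡⟨ interchange (ℕ→ℚ D) (ℕ→ℚ (D ^ N)) x (powℚ x N) ⟩
  ℕ→ℚ D *ℚ x *ℚ (ℕ→ℚ (D ^ N) *ℚ powℚ x N)
    ≡⟨ cong₂ _*ℚ_ (ℕ→ℚ-*-recipℕ D) (ℕ→ℚ-^-*-powℚ-recipℕ D N) ⟩
  1ℚ *ℚ 1ℚ
    ≡⟨⟩
  1ℚ
    ∎
  where
  open ≡-Reasoning
  x : ℚ
  x = recipℕ D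

partialGF-horner : ∀ t D .{{_ : NonZero D}} N →
  ℕ→ℚ (D ^ N) *ℚ partialGF t (recipℕ D) (suc N) ≡ ℕ→ℚ (horner D t (suc N))
partialGF-horner t D zero = begin
  1ℚ *ℚ (0ℚ +ℚ ℕ→ℚ (t 0) *ℚ 1ℚ)  ≡⟨ ℚP.*-identityˡ _ ⟩
  0ℚ +ℚ ℕ→ℚ (t 0) *ℚ 1ℚ          ≡⟨ ℚP.+-identityˡ _ ⟩
  ℕ→ℚ (t 0) *ℚ 1ℚ                ≡⟨ ℚP.*-identityʳ _ ⟩
  ℕ→ℚ (t 0)                      ≡⟨ cong (λ h → ℕ→ℚ (h + t 0)) (sym (*-zeroʳ D)) ⟩
  ℕ→ℚ (D * 0 + t 0)              ∎
  where open ≡-Reasoning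
partialGF-horner t D (suc N) = begin
  ℕ→ℚ (D ^ suc N) *ℚ (P +ℚ ℕ→ℚ (t (suc N)) *ℚ powℚ x (suc N))
    ≡⟨ ℚP.*-distribˡ-+ (ℕ→ℚ (D ^ suc N)) P _ ⟩
  ℕ→ℚ (D * D ^ N) *ℚ P +ℚ ℕ→ℚ (D ^ suc N) *ℚ (ℕ→ℚ (t (suc N)) *ℚ powℚ x (suc N))
    ≡⟨ cong₂ _+ℚ_ (ℕ→ℚ-*-assoc D (D ^ N) (partialGF-horner t D N))
                   (x∙yz≈y∙xz (ℕ→ℚ (D ^ suc N)) (ℕ→ℚ (t (suc N))) (powℚ x (suc N))) ⟩
  ℕ→ℚ (D * horner D t (suc N)) +ℚ ℕ→ℚ (t (suc N)) *ℚ (ℕ→ℚ (D ^ suc N) *ℚ powℚ x (suc N))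
    ≡⟨ cong (λ y → ℕ→ℚ (D * horner D t (suc N)) +ℚ ℕ→ℚ (t (suc N)) *ℚ y)
            (ℕ→ℚ-^-*-powℚ-recipℕ D (suc N)) ⟩
  ℕ→ℚ (D * horner D t (suc N)) +ℚ ℕ→ℚ (t (suc N)) *ℚ 1ℚ
    ≡⟨ cong (ℕ→ℚ (D * horner D t (suc N)) +ℚ_) (ℚP.*-identityʳ _) ⟩
  ℕ→ℚ (D * horner D t (suc N)) +ℚ ℕ→ℚ (t (suc N))
    ≡⟨ sym (ℕ→ℚ-+ (D * horner D t (suc N)) (t (suc N))) ⟩
  ℕ→ℚ (horner D t (suc (suc N)))
    ∎
  where
  open ≡-Reasoning
  x : ℚ
  x = recipℕ D
  P : ℚ
  P = partialGF t x (suc N)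

powℚ-nonNeg : ∀ {z} → 0ℚ ≤ℚ z → ∀ N → 0ℚ ≤ℚ powℚ z N
powℚ-nonNeg 0≤z zero    = ℕ→ℚ-nonNeg 1
powℚ-nonNeg 0≤z (suc N) = *-nonNeg 0≤z (powℚ-nonNeg 0≤z N)

partialGF-mono : ∀ t {z} → 0ℚ ≤ℚ z → ∀ d N → partialGF t z N ≤ℚ partialGF t z (d + N)
partialGF-mono t     0≤z zero    N = ℚP.≤-refl
partialGF-mono t {z} 0≤z (suc d) N = ℚP.≤-trans (partialGF-mono t 0≤z d N) (begin
  P                                        ≡⟨ sym (ℚP.+-identityʳ P) ⟩
  P +ℚ 0ℚ                                  ≤⟨ ℚP.+-monoʳ-≤ P 0≤term ⟩
  P +ℚ ℕ→ℚ (t (d + N)) *ℚ powℚ z (d + N)  ∎)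
  where
  open ℚP.≤-Reasoning
  P : ℚ
  P = partialGF t z (d + N)
  0≤term : 0ℚ ≤ℚ ℕ→ℚ (t (d + N)) *ℚ powℚ z (d + N)
  0≤term = *-nonNeg (ℕ→ℚ-nonNeg (t (d + N))) (powℚ-nonNeg 0≤z (d + N))

isFloorOfLimit-attained : ∀ {k s} N q → s N ≡ ℕ→ℚ k → (∀ N → s N ≤ℚ q) → q <ℚ ℕ→ℚ (suc k) →
  IsFloorOfLimit k s
isFloorOfLimit-attained N q sN≡k s≤q q<1+k =
  (λ p p<k → N , subst (p <ℚ_) (sym sN≡k) p<k) , q , q<1+k , s≤q

module _ (t : ℕ → ℕ) (D : ℕ) .{{_ : NonZero D}} (n : ℕ)
         (tail-bound : ∀ N → D * horner D (λ j → t (suc n + j)) N + D ^ N ≤ D ^ suc N) where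

  private
    k c : ℕ
    k = horner D t (suc n)
    c = k * D + pred D

    -- q = k + 1 - 1/D
    q : ℚ
    q = recipℕ D *ℚ ℕ→ℚ c

    s : ℕ → ℚ
    s N = ℕ→ℚ (D ^ n) *ℚ partialGF t (recipℕ D) N

    D*q≡c : ℕ→ℚ D *ℚ q ≡ ℕ→ℚ c
    D*q≡c = begin
      ℕ→ℚ D *ℚ (recipℕ D *ℚ ℕ→ℚ c)  ≡⟨ sym (ℚP.*-assoc (ℕ→ℚ D) (recipℕ D) (ℕ→ℚ c)) ⟩
      ℕ→ℚ D *ℚ recipℕ D *ℚ ℕ→ℚ c    ≡⟨ cong (_*ℚ ℕ→ℚ c) (ℕ→ℚ-*-recipℕ D) ⟩
      1ℚ *ℚ ℕ→ℚ c                   ≡⟨ ℚP.*-identityˡ (ℕ→ℚ c) ⟩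
      ℕ→ℚ c                         ∎
      where open ≡-Reasoning

    q<1+k : q <ℚ ℕ→ℚ (suc k)
    q<1+k = ℕ-scaled-< D D*q≡c (sym (ℕ→ℚ-* D (suc k))) (begin-strict
      k * D + pred D  <⟨ +-monoʳ-< (k * D) (subst (pred D <_) (suc-pred D) (n<1+n (pred D))) ⟩
      k * D + D       ≡⟨ +-comm (k * D) D ⟩
      D + k * D       ≡⟨ cong (D +_) (*-comm k D) ⟩
      D + D * k       ≡⟨ sym (*-suc D k) ⟩
      D * suc k       ∎)
      where open ≤-Reasoning

    D*horner≤D^N*c : ∀ N → D * horner D t (suc n + N) ≤ D ^ N * c
    D*horner≤D^N*c N = begin
      D * horner D t (suc n + N)          ≡⟨ cong (D *_) (horner-+ D t (suc n) N) ⟩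
      D * (D ^ N * k + T)                 ≡⟨ regroup D (D ^ N) k T ⟩
      D ^ N * (k * D) + D * T             ≤⟨ +-monoʳ-≤ (D ^ N * (k * D)) D*T≤D^N*predD ⟩
      D ^ N * (k * D) + D ^ N * pred D    ≡⟨ sym (*-distribˡ-+ (D ^ N) (k * D) (pred D)) ⟩
      D ^ N * c                           ∎
      where
      open ≤-Reasoning
      T : ℕ
      T = horner D (λ j → t (suc n + j)) N
      regroup : ∀ d p k T → d * (p * k + T) ≡ p * (k * d) + d * T
      regroup = solve-∀
      D^[1+N]≡ : D ^ suc N ≡ D ^ N * pred D + D ^ N
      D^[1+N]≡ = begin-equality
        D * D ^ N                ≡⟨ *-comm D (D ^ N) ⟩
        D ^ N * D                ≡⟨ cong (D ^ N *_) (sym (suc-pred D)) ⟩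
        D ^ N * suc (pred D)     ≡⟨ *-suc (D ^ N) (pred D) ⟩
        D ^ N + D ^ N * pred D   ≡⟨ +-comm (D ^ N) (D ^ N * pred D) ⟩
        D ^ N * pred D + D ^ N   ∎
      D*T≤D^N*predD : D * T ≤ D ^ N * pred D
      D*T≤D^N*predD = +-cancelʳ-≤ (D ^ N) (D * T) (D ^ N * pred D)
        (≤-trans (tail-bound N) (≤-reflexive D^[1+N]≡))

    s[1+n+N]≤q : ∀ N → s (suc n + N) ≤ℚ q
    s[1+n+N]≤q N =
      ℕ-scaled-≤ (D ^ suc N) {{m^n≢0 D (suc N)}} scaled-s scaled-q (D*horner≤D^N*c N)
      where
      open ≡-Reasoning
      P : ℚ
      P = partialGF t (recipℕ D) (suc n + N)
      scaled-s : ℕ→ℚ (D ^ suc N) *ℚ s (suc n + N) ≡ ℕ→ℚ (D * horner D t (suc n + N))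
      scaled-s = begin
        ℕ→ℚ (D ^ suc N) *ℚ (ℕ→ℚ (D ^ n) *ℚ P)  ≡⟨ sym (ℚP.*-assoc (ℕ→ℚ (D ^ suc N)) (ℕ→ℚ (D ^ n)) P) ⟩
        ℕ→ℚ (D ^ suc N) *ℚ ℕ→ℚ (D ^ n) *ℚ P    ≡⟨ cong (_*ℚ P) (sym (ℕ→ℚ-* (D ^ suc N) (D ^ n))) ⟩
        ℕ→ℚ (D ^ suc N * D ^ n) *ℚ P           ≡⟨ cong (λ m → ℕ→ℚ m *ℚ P) (sym (^-distribˡ-+-* D (suc N) n)) ⟩
        ℕ→ℚ (D * D ^ (N + n)) *ℚ P             ≡⟨ cong (λ m → ℕ→ℚ (D * D ^ m) *ℚ P) (+-comm N n) ⟩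
        ℕ→ℚ (D * D ^ (n + N)) *ℚ P             ≡⟨ ℕ→ℚ-*-assoc D (D ^ (n + N)) (partialGF-horner t D (n + N)) ⟩
        ℕ→ℚ (D * horner D t (suc n + N))       ∎
      scaled-q : ℕ→ℚ (D ^ suc N) *ℚ q ≡ ℕ→ℚ (D ^ N * c)
      scaled-q = begin
        ℕ→ℚ (D * D ^ N) *ℚ q   ≡⟨ cong (λ m → ℕ→ℚ m *ℚ q) (*-comm D (D ^ N)) ⟩
        ℕ→ℚ (D ^ N * D) *ℚ q   ≡⟨ ℕ→ℚ-*-assoc (D ^ N) D D*q≡c ⟩
        ℕ→ℚ (D ^ N * c)        ∎

    s≤q : ∀ N → s N ≤ℚ q
    s≤q N = ℚP.≤-trans
      (ℚP.*-monoˡ-≤-nonNeg (ℕ→ℚ (D ^ n)) {{ℚ.nonNegative (ℕ→ℚ-nonNeg (D ^ n))}}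
        (partialGF-mono t (recipℕ-nonNeg D) (suc n) N))
      (s[1+n+N]≤q N)

  horner-isFloorOfLimit :
    IsFloorOfLimit (horner D t (suc n)) (λ N → ℕ→ℚ (D ^ n) *ℚ partialGF t (recipℕ D) N)
  horner-isFloorOfLimit = isFloorOfLimit-attained {k} {s} (suc n) q (partialGF-horner t D n) s≤q q<1+k

theorem4p1 : (t : ℕ → ℕ) (b m n : ℕ) →
    2 ≤ b → 2 ≤ m → m ≤ n →
    RadiusGreaterThan t (recipℕ (b ^ m)) →
    (∀ r → m ≤ r → t r < b ^ (r ∸ 2)) →
    Σ ℕ λ k →
      IsFloorOfLimit k (λ N → ℕ→ℚ (b ^ (n * n)) *ℚ partialGF t (recipℕ (b ^ n)) N)
      × t n ≡ modℕ k (b ^ n)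
theorem4p1 t b m n 2≤b@(s≤s (s≤s _)) 2≤m m≤n _ t<b^[r∸2] with ≤-trans 2≤m m≤n
... | s≤s (s≤s _) =
  horner D t (suc n) ,
  subst (λ p → IsFloorOfLimit (horner D t (suc n)) (λ N → ℕ→ℚ p *ℚ partialGF t (recipℕ D) N))
    (^-*-assoc b n n) (horner-isFloorOfLimit t D {{m^n≢0 b n}} n tail-bound) ,
  sym (horner-suc-mod D t n t[n]<D)
  where
  D : ℕ
  D = b ^ n
  tail-bound : ∀ N → D * horner D (λ j → t (suc n + j)) N + D ^ N ≤ D ^ suc N
  tail-bound = horner-tail-bound {e = pred n} 2≤b (s≤s z≤n) (λ j → t (suc n + j))
    (λ j → t<b^[r∸2] (suc n + j) (≤-trans m≤n (≤-trans (n≤1+n n) (m≤m+n (suc n) j))))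
  t[n]<D : t n < D
  t[n]<D = <-≤-trans (t<b^[r∸2] n m≤n) (^-monoʳ-≤ b (m∸n≤m n 2))
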